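{- Consider any algorithm following the two-phase framework that satisfies the interference property and is governed by parameters $\Delta$ (critical set size) and $\lambda$ (slackness). Then the feasible solution $S$ produced by the algorithm satisfies $p(S)\geq \frac{\lambda}{\Delta+1}\, p(\mathrm{Opt})$.
   Context: Setting (unit height tree-networks): $V$ is a vertex set and $\mathcal{T}$ is a set of trees on $V$. Each demand $a$ is a vertex pair with profit $p(a)$. $\mathcal{D}$ is the set of demand instances, where an instance $d$ is a copy of a demand $a_d$ placed on some tree $T$ (among those accessible to $a_d$'s owner); it has profit $p(d)=p(a_d)$ and path $\mathrm{path}(d)$ in $T$. Two instances overlap if they lie on the same tree and their paths share an edge. They conflict if they overlap or belong to the same demand. An independent set is a set of pairwise non-conflicting instances, and feasible solutions are exactly the independent sets. $\mathrm{Opt}$ is a maximum-profit feasible solution. $\mathcal{E}$ is the set of all edges of all trees. Dual variables: $\alpha(a)\ge 0$ for each demand $a$ and $\beta(e)\ge0$ for each $e\in\mathcal{E}$. The dual constraint of $d$ is $\alpha(a_d)+\sum_{e\in \mathrm{path}(d)}\beta(e)\geq p(d)$. Two-phase framework. In the first phase, all duals start at $0$ and the stack is empty. Each iteration selects some independent set $I$ of instances whose dual constraints are unsatisfied. For each $d\in I$, it computes the slackness $s=p(d)-\alpha(a_d)-\sum_{e\in\mathrm{path}(d)}\beta(e)$, chooses a set $\pi(d)$ of edges of $\mathrm{path}(d)$ (the critical edges), and sets $\delta(d)=s/(|\pi(d)|+1)$. It increases $\alpha(a_d)$ and each $\beta(e)$, $e\in\pi(d)$, by $\delta(d)$ ("$d$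 is raised"), and then pushes $I$ onto the stack. The first phase ends at an algorithm-chosen point. In the second phase, starting with $S=\emptyset$, sets are popped from the stack in reverse order; each $d$ in a popped set is added to $S$ if $S\cup\{d\}$ is independent. The output is $S$. Interference property: for any two overlapping instances $d_1,d_2$ both raised in the first phase with $d_1$ raised before $d_2$, $\mathrm{path}(d_2)$ contains some edge of $\pi(d_1)$. Parameters: $\Delta$ is the maximum of $|\pi(d)|$ over raised $d$. An instance is $\xi$-satisfied if $\alpha(a_d)+\sum_{e\in\mathrm{path}(d)}\beta(e)\ge \xi p(d)$, and $\lambda\in[0,1]$ is the largest number such that every $d\in\mathcal{D}$ is $\lambda$-satisfied at the end of the first phase. -}

module Defs where

open import Data.Nat as ℕ using (ℕ; suc; _⊔_)
open import Data.Fin using (Fin; _≟_)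
open import Data.Product using (Σ; ∃; _×_; _,_; proj₁; proj₂)
open import Data.Sum using (_⊎_)
open import Data.List using (List; []; _∷_; length; foldr; map; concat; reverse)
open import Data.Bool.ListAction using (any)
open import Data.Unit using (⊤)
open import Data.Maybe using (Maybe; just; nothing)
open import Data.List.Membership.Propositional using (_∈_)
open import Data.List.Relation.Unary.Unique.Propositional using (Unique)
open import Data.List.Relation.Unary.All using (All)
open import Data.Bool using (Bool; true; false; if_then_else_; _∨_; not)
open import Data.Integer using (+_)
open import Data.Rational using (ℚ; 0ℚ; _+_; _-_; _*_; _/_; _≤_; _<_)
open import Relation.Binary.PropositionalEquality using (_≡_)
open import Relation.Nullary using (¬_)
open import Relation.Nullary.Decidable using (⌊_⌋)
open import Data.Empty using (⊥)

-- The edge set of tree t is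
-- { e | treeOf e ≡ t }; so 𝓔 = Fin ne is the disjoint union of the trees'
-- edge sets.

record Graph : Set where
  field
    nv ne ntree : ℕ
    ends   : Fin ne → Fin nv × Fin nv
    treeOf : Fin ne → Fin ntree

module _ (G : Graph) where
  open Graph G

  Joins : Fin ne → Fin nv → Fin nv → Set
  Joins e u w = (ends e ≡ (u , w)) ⊎ (ends e ≡ (w , u))

  data Walk (t : Fin ntree) : Fin nv → Fin nv → Set where
    [] : ∀ {u} → Walk t u u
    step : ∀ {u w v} (e : Fin ne) → treeOf e ≡ t → Joins e u w →
           Walk t w v → Walk t u v

  edgesW : ∀ {t u v} → Walk t u v → List (Fin ne)
  edgesW [] = []
  edgesW (step e _ _ w) = e ∷ edgesW w

  vertsW : ∀ {t u v} → Walk t u v → List (Fin nv)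
  vertsW {u = u} [] = u ∷ []
  vertsW {u = u} (step e _ _ w) = u ∷ vertsW w

  vertsTail : ∀ {t u v} → Walk t u v → List (Fin nv)
  vertsTail [] = []
  vertsTail (step e _ _ w) = vertsW w

  IsPath : ∀ {t u v} → Walk t u v → Set
  IsPath w = Unique (vertsW w)

  IsCycle : ∀ {t u} → Walk t u u → Set
  IsCycle w = (1 ℕ.≤ length (edgesW w)) × Unique (edgesW w) × Unique (vertsTail w)

  VertexOf : Fin ntree → Fin nv → Set
  VertexOf t u = Σ (Fin ne) λ e → treeOf e ≡ t × Σ (Fin nv) λ w → Joins e u w

  IsTree : Fin ntree → Set
  IsTree t =
    (∀ u v → VertexOf t u → VertexOf t v → Σ (Walk t u v) IsPath) ×
    (∀ u (w : Walk t u u) → ¬ IsCycle w)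

record Problem : Set where
  field
    graph   : Graph
  open Graph graph public
  field
    trees   : ∀ t → IsTree graph t
    nd      : ℕ
    src tgt : Fin nd → Fin nv
    profit  : Fin nd → ℚ
    profit≥0 : ∀ a → 0ℚ ≤ profit a
    -- demand instances: copy of demand dem d on tree tr d (accessible trees
    -- are arbitrary), with its path in that tree
    ninst   : ℕ
    dem     : Fin ninst → Fin nd
    tr      : Fin ninst → Fin ntree
    pathW   : ∀ d → Walk graph (tr d) (src (dem d)) (tgt (dem d))
    pathW-simple : ∀ d → IsPath graph (pathW d)
    copies-distinct : ∀ d d' → dem d ≡ dem d' → tr d ≡ tr d' → d ≡ d'

module _ (P : Problem) where
  open Problem P

  Inst : Set
  Inst = Fin ninst

  Edge : Set
  Edge = Fin ne

  path : Inst → List Edge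
  path d = edgesW graph (pathW d)

  p : Inst → ℚ
  p d = profit (dem d)

  -- overlap: same tree and a common edge (edges are tree-specific, so a
  -- common edge already forces the same tree)
  Overlap : Inst → Inst → Set
  Overlap d d' = tr d ≡ tr d' × Σ Edge λ e → e ∈ path d × e ∈ path d'

  Conflict : Inst → Inst → Set
  Conflict d d' = Overlap d d' ⊎ dem d ≡ dem d'

  Independent : List Inst → Set
  Independent I = Unique I ×
    (∀ d d' → d ∈ I → d' ∈ I → ¬ d ≡ d' → ¬ Conflict d d')

  profitOf : List Inst → ℚ
  profitOf S = foldr (λ d acc → p d + acc) 0ℚ S

  sumℚ : List ℚ → ℚ
  sumℚ = foldr _+_ 0ℚ

  record Duals : Set where
    constructor duals
    field
      α : Fin nd → ℚ
      β : Edge → ℚ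
  open Duals public

  zeroDuals : Duals
  zeroDuals = duals (λ _ → 0ℚ) (λ _ → 0ℚ)

  lhs : Duals → Inst → ℚ
  lhs y d = α y (dem d) + sumℚ (map (β y) (path d))

  slack : Duals → Inst → ℚ
  slack y d = p d - lhs y d

  Unsatisfied : Duals → Inst → Set
  Unsatisfied y d = lhs y d < p d

  Satisfied : ℚ → Duals → Inst → Set
  Satisfied ξ y d = ξ * p d ≤ lhs y d

  raise : Duals → Inst → List Edge → Duals
  raise y d π = duals α' β'
    where
      δ : ℚ
      δ = slack y d * ((+ 1) / suc (length π))
      α' : Fin nd → ℚ
      α' a = if ⌊ a ≟ dem d ⌋ then α y a + δ else α y a
      β' : Edge → ℚ
      β' e = if any (λ e' → ⌊ e ≟ e' ⌋) π then β y e + δ else β y e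

  -- one iteration: a list of (instance, critical set) pairs
  Iter : Set
  Iter = List (Inst × List Edge)

  -- raise each instance of the iteration (members are independent, so the
  -- order is irrelevant)
  raiseIter : Duals → Iter → Duals
  raiseIter y [] = y
  raiseIter y ((d , π) ∷ it) = raiseIter (raise y d π) it

  ValidIter : Duals → Iter → Set
  ValidIter y it =
    Independent (map proj₁ it) ×
    All (λ dπ → Unsatisfied y (proj₁ dπ) ×
                Unique (proj₂ dπ) ×
                (∀ e → e ∈ proj₂ dπ → e ∈ path (proj₁ dπ))) it

  -- A first-phase run: the stack, listed bottom (first pushed) to top.
  -- Valid y its: each iteration is valid w.r.t. the duals reached so far.
  ValidRun : Duals → List Iter → Set
  ValidRun y [] = ⊤
  ValidRun y (it ∷ its) = ValidIter y it × ValidRun (raiseIter y it) its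

  finalDuals : Duals → List Iter → Duals
  finalDuals y [] = y
  finalDuals y (it ∷ its) = finalDuals (raiseIter y it) its

  raised : List Iter → List (Inst × List Edge)
  raised = concat

  Δ : List Iter → ℕ
  Δ its = foldr (λ dπ m → length (proj₂ dπ) ⊔ m) 0 (raised its)

  conflict? : Inst → Inst → Bool
  conflict? d d' = ⌊ dem d ≟ dem d' ⌋ ∨
    (⌊ tr d ≟ tr d' ⌋ Data.Bool.∧ any (λ e → any (λ e' → ⌊ e ≟ e' ⌋) (path d')) (path d))
    where import Data.Bool

  -- second phase: pop sets from the top of the stack; add d to S if
  -- S ∪ {d} is independent
  addIfOk : Inst → List Inst → List Inst
  addIfOk d S = if any (conflict? d) S then S else d ∷ S

  phase2 : List Iter → List Inst
  phase2 its = foldr (λ d S → addIfOk d S) [] (reverse (concat (map (map proj₁) (reverse its))))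

  -- k-th raising event (0-based) of the first phase, in chronological order
  lookupℕ : List (Inst × List Edge) → ℕ → Maybe (Inst × List Edge)
  lookupℕ [] _ = nothing
  lookupℕ (x ∷ xs) ℕ.zero = just x
  lookupℕ (x ∷ xs) (suc k) = lookupℕ xs k

  IthRaised : List Iter → ℕ → Inst × List Edge → Set
  IthRaised its k x = lookupℕ (raised its) k ≡ just x

  Interference : List Iter → Set
  Interference its = ∀ (i j : ℕ) (d₁ d₂ : Inst) (π₁ π₂ : List Edge) →
    IthRaised its i (d₁ , π₁) → IthRaised its j (d₂ , π₂) → i ℕ.< j →
    Overlap d₁ d₂ → Σ Edge λ e → e ∈ π₁ × e ∈ path d₂

module Submission where

open import Defs
open import Data.Nat as ℕ using (ℕ; zero; suc; _⊔_)
import Data.Nat.Properties as ℕ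
open import Data.Nat.Coprimality as Coprime using (1-coprimeTo)
import Data.Integer as ℤ
import Data.Integer.Properties as ℤ
open import Data.Rational
  using (ℚ; mkℚ; 0ℚ; 1ℚ; _+_; _*_; _-_; -_; _/_; _≤_; _<_; nonNegative)
import Data.Rational.Properties as ℚ
open import Data.Rational.Unnormalised using (*≡*)
import Data.Rational.Unnormalised.Properties as ℚᵘ
open import Data.Rational.Solver using (module +-*-Solver)
open import Data.Bool using (Bool; true; false; if_then_else_; not; _∨_; T)
import Data.Bool.Properties as Bool
open import Data.Bool.ListAction using (any)
open import Data.Fin using (Fin; _≟_)
import Data.Fin as Fin
open import Data.Product as Prod using (Σ; _×_; _,_; proj₁; proj₂)
open import Data.Sum as Sum using (_⊎_; inj₁; inj₂)
open import Data.Unit using (⊤; tt)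
open import Data.Maybe using (just)
open import Data.List using (List; []; _∷_; _++_; map; foldr; foldl; concat; length; reverse)
import Data.List.Properties as List
open import Data.List.Membership.Propositional using (_∈_; _∉_; find)
open import Data.List.Membership.Propositional.Properties using (∈-map⁺; ∈-++⁺ˡ; ∈-++⁺ʳ)
open import Data.List.Relation.Unary.Any using (here; there)
import Data.List.Relation.Unary.Any.Properties as Any
open import Data.List.Relation.Unary.All as All using (All; []; _∷_)
import Data.List.Relation.Unary.All.Properties as All
open import Data.List.Relation.Unary.AllPairs as AllPairs using (AllPairs; []; _∷_)
import Data.List.Relation.Unary.AllPairs.Properties as AllPairs
open import Data.List.Relation.Unary.Unique.Propositional using (Unique)
import Data.List.Relation.Unary.Unique.Propositional.Properties as Unique
open import Function using (_∘′_; flip; Equivalence)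
open import Relation.Nullary using (¬_; yes; no; contradiction)
open import Relation.Nullary.Decidable using (⌊_⌋; ⌊⌋-map′; toWitness)
open import Relation.Binary.PropositionalEquality
open import Algebra.Properties.CommutativeMonoid.Sum ℚ.+-0-commutativeMonoid
  using (sum; sum-cong-≗; ∑-distrib-+; sum-replicate-zero)

-- Weak duality against a charging argument. Raising d increases the dual objective
-- Σα + Σβ by at most (|π(d)| + 1) δ(d) ≤ (Δ + 1) δ(d), so at the end of phase one it is at
-- most (Δ + 1) D, D the sum of all the δ's; since every instance is λ-satisfied and Opt uses
-- distinct demands and edge-disjoint paths, λ p(Opt) is at most that dual objective.
-- Conversely D ≤ p(S). Going down the stack, an instance added to S pays its own δ, which is
-- at most its slack. A rejected instance d conflicts with some x already in S, hence raised
-- after d, and by the interference property raising d increased the left-hand side of x's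
-- constraint by at least δ(d); as p(x) is at least that left-hand side at the time x was
-- raised plus δ(x), x pays for d too.

fromℕ : ℕ → ℚ
fromℕ n = ℤ.+ n / 1

1/[1+_] : ℕ → ℚ
1/[1+ n ] = ℤ.+ 1 / suc n

-- _/_ normalises by a gcd, which does not compute on variables; the coprime form does.
fromℕ≡mkℚ : ∀ n → fromℕ n ≡ mkℚ (ℤ.+ n) 0 (Coprime.sym (1-coprimeTo n))
fromℕ≡mkℚ n = ℚ.normalize-coprime (Coprime.sym (1-coprimeTo n))

fromℕ-suc : ∀ n → fromℕ (suc n) ≡ 1ℚ + fromℕ n
fromℕ-suc n rewrite fromℕ≡mkℚ (suc n) | fromℕ≡mkℚ n =
  ℚ.toℚᵘ-injective (ℚᵘ.≃-sym (ℚᵘ.≃-trans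
    (ℚ.toℚᵘ-homo-+ 1ℚ (mkℚ (ℤ.+ n) 0 (Coprime.sym (1-coprimeTo n))))
    (*≡* (trans (ℤ.*-identityʳ _)
           (trans (cong (λ k → ℤ.+ 1 ℤ.+ k) (ℤ.*-identityʳ (ℤ.+ n))) (sym (ℤ.*-identityʳ _)))))))

1/[1+n]*[1+n]≡1 : ∀ n → 1/[1+ n ] * fromℕ (suc n) ≡ 1ℚ
1/[1+n]*[1+n]≡1 n rewrite fromℕ≡mkℚ (suc n) | ℚ.normalize-coprime (1-coprimeTo (suc n)) =
  ℚ.*-inverseˡ (mkℚ (ℤ.+ suc n) 0 (Coprime.sym (1-coprimeTo (suc n))))

1/[1+n]*[[1+n]*p]≡p : ∀ n p → 1/[1+ n ] * (fromℕ (suc n) * p) ≡ p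
1/[1+n]*[[1+n]*p]≡p n p = begin
  1/[1+ n ] * (fromℕ (suc n) * p)  ≡⟨ ℚ.*-assoc 1/[1+ n ] (fromℕ (suc n)) p ⟨
  1/[1+ n ] * fromℕ (suc n) * p    ≡⟨ cong (_* p) (1/[1+n]*[1+n]≡1 n) ⟩
  1ℚ * p                           ≡⟨ ℚ.*-identityˡ p ⟩
  p                                ∎
  where open ≡-Reasoning

x+k*a+k*b≡x+k*[a+b] : ∀ x k a b → x + k * a + k * b ≡ x + k * (a + b)
x+k*a+k*b≡x+k*[a+b] = solve 4 (λ x k a b → x :+ k :* a :+ k :* b := x :+ k :* (a :+ b)) refl
  where open +-*-Solver

x≡x+k*0 : ∀ x k → x ≡ x + k * 0ℚ
x≡x+k*0 x k = sym (trans (cong (x +_) (ℚ.*-zeroʳ k)) (ℚ.+-identityʳ x))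

p≤p+q : ∀ p {q} → 0ℚ ≤ q → p ≤ p + q
p≤p+q p {q} 0≤q = begin
  p       ≡⟨ ℚ.+-identityʳ p ⟨
  p + 0ℚ  ≤⟨ ℚ.+-monoʳ-≤ p 0≤q ⟩
  p + q   ∎
  where open ℚ.≤-Reasoning

p≤q+p : ∀ {p q} → 0ℚ ≤ q → p ≤ q + p
p≤q+p {p} {q} 0≤q = subst (p ≤_) (ℚ.+-comm p q) (p≤p+q p 0≤q)

p≤q⇒0≤q-p : ∀ {p q} → p ≤ q → 0ℚ ≤ q - p
p≤q⇒0≤q-p {p} {q} p≤q = begin
  0ℚ     ≡⟨ ℚ.+-inverseʳ p ⟨
  p - p  ≤⟨ ℚ.+-monoˡ-≤ (- p) p≤q ⟩
  q - p  ∎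
  where open ℚ.≤-Reasoning

*-monoˡ-≤ : ∀ {r p q} → 0ℚ ≤ r → p ≤ q → r * p ≤ r * q
*-monoˡ-≤ {r} 0≤r = ℚ.*-monoˡ-≤-nonNeg r {{nonNegative 0≤r}}

*-monoʳ-≤ : ∀ {r p q} → 0ℚ ≤ r → p ≤ q → p * r ≤ q * r
*-monoʳ-≤ {r} 0≤r = ℚ.*-monoʳ-≤-nonNeg r {{nonNegative 0≤r}}

+-nonNeg : ∀ {p q} → 0ℚ ≤ p → 0ℚ ≤ q → 0ℚ ≤ p + q
+-nonNeg = ℚ.+-mono-≤

*-nonNeg : ∀ {p q} → 0ℚ ≤ p → 0ℚ ≤ q → 0ℚ ≤ p * q
*-nonNeg {p} {q} 0≤p 0≤q =
  ℚ.nonNegative⁻¹ _ {{ℚ.nonNeg*nonNeg⇒nonNeg p {{nonNegative 0≤p}} q {{nonNegative 0≤q}}}}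

fromℕ-nonNeg : ∀ n → 0ℚ ≤ fromℕ n
fromℕ-nonNeg n = ℚ.nonNegative⁻¹ _ {{ℚ.normalize-nonNeg n 1}}

1/[1+n]-nonNeg : ∀ n → 0ℚ ≤ 1/[1+ n ]
1/[1+n]-nonNeg n = ℚ.nonNegative⁻¹ _ {{ℚ.normalize-nonNeg 1 (suc n)}}

fromℕ-mono-≤ : ∀ {m n} → m ℕ.≤ n → fromℕ m ≤ fromℕ n
fromℕ-mono-≤ {zero}  {n}     _           = fromℕ-nonNeg n
fromℕ-mono-≤ {suc m} {suc n} (ℕ.s≤s m≤n) = begin
  fromℕ (suc m)  ≡⟨ fromℕ-suc m ⟩
  1ℚ + fromℕ m   ≤⟨ ℚ.+-monoʳ-≤ 1ℚ (fromℕ-mono-≤ m≤n) ⟩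
  1ℚ + fromℕ n   ≡⟨ fromℕ-suc n ⟨
  fromℕ (suc n)  ∎
  where open ℚ.≤-Reasoning

*1/[1+n]≤ : ∀ n {p} → 0ℚ ≤ p → p * 1/[1+ n ] ≤ p
*1/[1+n]≤ n {p} 0≤p = begin
  p * 1/[1+ n ]  ≤⟨ *-monoˡ-≤ 0≤p 1/[1+n]≤1 ⟩
  p * 1ℚ         ≡⟨ ℚ.*-identityʳ p ⟩
  p              ∎
  where
  open ℚ.≤-Reasoning
  1/[1+n]≤1 : 1/[1+ n ] ≤ 1ℚ
  1/[1+n]≤1 = begin
    1/[1+ n ]                  ≡⟨ ℚ.*-identityʳ _ ⟨
    1/[1+ n ] * 1ℚ             ≤⟨ *-monoˡ-≤ (1/[1+n]-nonNeg n) (fromℕ-mono-≤ {1} {suc n} (ℕ.s≤s ℕ.z≤n)) ⟩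
    1/[1+ n ] * fromℕ (suc n)  ≡⟨ 1/[1+n]*[1+n]≡1 n ⟩
    1ℚ                         ∎

infixr 7 _·_

_·_ : Bool → ℚ → ℚ
true  · p = p
false · p = 0ℚ

if-+≡+· : ∀ b p q → (if b then p + q else p) ≡ p + b · q
if-+≡+· true  p q = refl
if-+≡+· false p q = sym (ℚ.+-identityʳ p)

·-nonNeg : ∀ b {p} → 0ℚ ≤ p → 0ℚ ≤ b · p
·-nonNeg true  0≤p = 0≤p
·-nonNeg false _   = ℚ.≤-refl

·-≤ : ∀ b {p q} → 0ℚ ≤ q → (T b → p ≤ q) → b · p ≤ q
·-≤ true  _   p≤q = p≤q _
·-≤ false 0≤q _   = 0≤q

∨-·-≤ : ∀ a b {p} → 0ℚ ≤ p → (a ∨ b) · p ≤ a · p + b · p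
∨-·-≤ true  b {p} 0≤p = p≤p+q p (·-nonNeg b 0≤p)
∨-·-≤ false b {p} 0≤p = ℚ.≤-reflexive (sym (ℚ.+-identityˡ (b · p)))

module _ {A : Set} where

  sumOf : (A → ℚ) → List A → ℚ
  sumOf f xs = foldr _+_ 0ℚ (map f xs)

  sumOf-mono-≤ : ∀ {f g : A → ℚ} xs → (∀ x → f x ≤ g x) → sumOf f xs ≤ sumOf g xs
  sumOf-mono-≤ []       f≤g = ℚ.≤-refl
  sumOf-mono-≤ (x ∷ xs) f≤g = ℚ.+-mono-≤ (f≤g x) (sumOf-mono-≤ xs f≤g)

  sumOf-cong : ∀ {f g : A → ℚ} xs → (∀ {x} → x ∈ xs → f x ≡ g x) → sumOf f xs ≡ sumOf g xs
  sumOf-cong []       f≗g = refl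
  sumOf-cong (x ∷ xs) f≗g = cong₂ _+_ (f≗g (here refl)) (sumOf-cong xs (f≗g ∘′ there))

  sumOf-nonNeg : ∀ {f : A → ℚ} xs → (∀ x → 0ℚ ≤ f x) → 0ℚ ≤ sumOf f xs
  sumOf-nonNeg []       0≤f = ℚ.≤-refl
  sumOf-nonNeg (x ∷ xs) 0≤f = +-nonNeg (0≤f x) (sumOf-nonNeg xs 0≤f)

  sumOf-zero : ∀ (xs : List A) → sumOf (λ _ → 0ℚ) xs ≡ 0ℚ
  sumOf-zero []       = refl
  sumOf-zero (x ∷ xs) = trans (ℚ.+-identityˡ _) (sumOf-zero xs)

  ∈⇒≤sumOf : ∀ {f : A → ℚ} xs {y} → (∀ x → 0ℚ ≤ f x) → y ∈ xs → f y ≤ sumOf f xs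
  ∈⇒≤sumOf {f} (x ∷ xs) 0≤f (here refl)  = p≤p+q (f x) (sumOf-nonNeg xs 0≤f)
  ∈⇒≤sumOf {f} (x ∷ xs) 0≤f (there y∈xs) = begin
    f _               ≡⟨ ℚ.+-identityˡ _ ⟨
    0ℚ + f _          ≤⟨ ℚ.+-mono-≤ (0≤f x) (∈⇒≤sumOf xs 0≤f y∈xs) ⟩
    f x + sumOf f xs  ∎
    where open ℚ.≤-Reasoning

  sumOf-+ : ∀ (f g : A → ℚ) xs → sumOf (λ x → f x + g x) xs ≡ sumOf f xs + sumOf g xs
  sumOf-+ f g []       = refl
  sumOf-+ f g (x ∷ xs) = begin
    f x + g x + sumOf (λ x → f x + g x) xs    ≡⟨ cong (f x + g x +_) (sumOf-+ f g xs) ⟩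
    f x + g x + (sumOf f xs + sumOf g xs)     ≡⟨ solve 4 (λ a b c d → a :+ b :+ (c :+ d) := a :+ c :+ (b :+ d))
                                                   refl (f x) (g x) (sumOf f xs) (sumOf g xs) ⟩
    f x + sumOf f xs + (g x + sumOf g xs)     ∎
    where open ≡-Reasoning; open +-*-Solver

  sumOf-*ˡ : ∀ (f : A → ℚ) c xs → sumOf (λ x → c * f x) xs ≡ c * sumOf f xs
  sumOf-*ˡ f c []       = sym (ℚ.*-zeroʳ c)
  sumOf-*ˡ f c (x ∷ xs) =
    trans (cong (c * f x +_) (sumOf-*ˡ f c xs)) (sym (ℚ.*-distribˡ-+ c (f x) (sumOf f xs)))

  sumOf-++ : ∀ (f : A → ℚ) xs ys → sumOf f (xs ++ ys) ≡ sumOf f xs + sumOf f ys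
  sumOf-++ f []       ys = sym (ℚ.+-identityˡ (sumOf f ys))
  sumOf-++ f (x ∷ xs) ys =
    trans (cong (f x +_) (sumOf-++ f xs ys)) (sym (ℚ.+-assoc (f x) (sumOf f xs) (sumOf f ys)))

sumOf-map : ∀ {A B : Set} (f : B → ℚ) (g : A → B) xs → sumOf f (map g xs) ≡ sumOf (λ x → f (g x)) xs
sumOf-map f g []       = refl
sumOf-map f g (x ∷ xs) = cong (f (g x) +_) (sumOf-map f g xs)

sumOf-concatMap : ∀ {A B : Set} (f : B → ℚ) (g : A → List B) xs →
                  sumOf f (concat (map g xs)) ≡ sumOf (λ x → sumOf f (g x)) xs
sumOf-concatMap f g []       = refl
sumOf-concatMap f g (x ∷ xs) = trans (sumOf-++ f (g x) _) (cong (sumOf f (g x) +_) (sumOf-concatMap f g xs))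

Unique⇒AllPairs : ∀ {A : Set} {R : A → A → Set} xs → Unique xs →
                  (∀ {x y} → x ∈ xs → y ∈ xs → x ≢ y → R x y) → AllPairs R xs
Unique⇒AllPairs []       []                _ = []
Unique⇒AllPairs (x ∷ xs) (x∉xs ∷ xs-unique) R-distinct =
  All.tabulate (λ y∈xs → R-distinct (here refl) (there y∈xs) (All.lookup x∉xs y∈xs))
  ∷ Unique⇒AllPairs xs xs-unique (λ x∈xs y∈xs → R-distinct (there x∈xs) (there y∈xs))

sum-mono-≤ : ∀ {n} {f g : Fin n → ℚ} → (∀ i → f i ≤ g i) → sum f ≤ sum g
sum-mono-≤ {zero}  f≤g = ℚ.≤-refl
sum-mono-≤ {suc n} f≤g = ℚ.+-mono-≤ (f≤g Fin.zero) (sum-mono-≤ (λ i → f≤g (Fin.suc i)))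

sum-nonNeg : ∀ {n} {f : Fin n → ℚ} → (∀ i → 0ℚ ≤ f i) → 0ℚ ≤ sum f
sum-nonNeg {n} {f} 0≤f = subst (_≤ sum f) (sum-replicate-zero n) (sum-mono-≤ {f = λ _ → 0ℚ} 0≤f)

sum-point : ∀ {n} (x : Fin n) p → sum (λ i → ⌊ i ≟ x ⌋ · p) ≡ p
sum-point {suc n} Fin.zero    p = trans (cong (p +_) (sum-replicate-zero n)) (ℚ.+-identityʳ p)
-- ⌊_⌋ matches on the decision, so ⌊ suc i ≟ suc x ⌋ is ⌊ i ≟ x ⌋ only propositionally.
sum-point {suc n} (Fin.suc x) p = begin
  0ℚ + sum (λ i → ⌊ Fin.suc i ≟ Fin.suc x ⌋ · p)
    ≡⟨ ℚ.+-identityˡ _ ⟩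
  sum (λ i → ⌊ Fin.suc i ≟ Fin.suc x ⌋ · p)
    ≡⟨ sum-cong-≗ (λ i → cong (_· p) (⌊⌋-map′ _ _ (i ≟ x))) ⟩
  sum (λ i → ⌊ i ≟ x ⌋ · p)
    ≡⟨ sum-point x p ⟩
  p ∎
  where open ≡-Reasoning

module _ {n : ℕ} where

  infix 6 _∈ᵇ_

  ≡⇒⌊≟⌋≡true : ∀ {a b : Fin n} → a ≡ b → ⌊ a ≟ b ⌋ ≡ true
  ≡⇒⌊≟⌋≡true {a} {b} a≡b with a ≟ b
  ... | yes _   = refl
  ... | no a≢b  = contradiction a≡b a≢b

  ≢⇒⌊≟⌋≡false : ∀ {a b : Fin n} → a ≢ b → ⌊ a ≟ b ⌋ ≡ false
  ≢⇒⌊≟⌋≡false {a} {b} a≢b with a ≟ b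
  ... | yes a≡b = contradiction a≡b a≢b
  ... | no _    = refl

  -- membership in the form tested by raise
  _∈ᵇ_ : Fin n → List (Fin n) → Bool
  e ∈ᵇ π = any (λ e′ → ⌊ e ≟ e′ ⌋) π

  ∈⇒∈ᵇ : ∀ {e π} → e ∈ π → e ∈ᵇ π ≡ true
  ∈⇒∈ᵇ {e} {x ∷ π} e∈π with e ≟ x
  ... | yes _ = refl
  ∈⇒∈ᵇ {e} {x ∷ π} (here e≡x)  | no e≢x = contradiction e≡x e≢x
  ∈⇒∈ᵇ {e} {x ∷ π} (there e∈π) | no _   = ∈⇒∈ᵇ e∈π

  ∉⇒∈ᵇ : ∀ {e π} → e ∉ π → e ∈ᵇ π ≡ false
  ∉⇒∈ᵇ {e} {[]}    e∉π = refl
  ∉⇒∈ᵇ {e} {x ∷ π} e∉π with e ≟ x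
  ... | yes e≡x = contradiction (here e≡x) e∉π
  ... | no _    = ∉⇒∈ᵇ (e∉π ∘′ there)

  ∈ᵇ⇒∈ : ∀ {e π} → T (e ∈ᵇ π) → e ∈ π
  ∈ᵇ⇒∈ {e} {x ∷ π} e∈ᵇπ with e ≟ x
  ... | yes e≡x = here e≡x
  ... | no _    = there (∈ᵇ⇒∈ e∈ᵇπ)

  sum-∈ᵇ-≤ : ∀ π {p} → 0ℚ ≤ p → sum (λ e → (e ∈ᵇ π) · p) ≤ fromℕ (length π) * p
  sum-∈ᵇ-≤ []      {p} 0≤p = begin
    sum {n} (λ _ → 0ℚ)  ≡⟨ sum-replicate-zero n ⟩
    0ℚ                  ≡⟨ ℚ.*-zeroˡ p ⟨
    0ℚ * p              ∎
    where open ℚ.≤-Reasoning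
  sum-∈ᵇ-≤ (x ∷ π) {p} 0≤p = begin
    sum (λ e → (⌊ e ≟ x ⌋ ∨ e ∈ᵇ π) · p)
      ≤⟨ sum-mono-≤ (λ e → ∨-·-≤ ⌊ e ≟ x ⌋ (e ∈ᵇ π) 0≤p) ⟩
    sum (λ e → ⌊ e ≟ x ⌋ · p + (e ∈ᵇ π) · p)
      ≡⟨ ∑-distrib-+ (λ e → ⌊ e ≟ x ⌋ · p) (λ e → (e ∈ᵇ π) · p) ⟩
    sum (λ e → ⌊ e ≟ x ⌋ · p) + sum (λ e → (e ∈ᵇ π) · p)
      ≤⟨ ℚ.+-mono-≤ (ℚ.≤-reflexive (sum-point x p)) (sum-∈ᵇ-≤ π 0≤p) ⟩
    p + fromℕ (length π) * p
      ≡⟨ cong (_+ fromℕ (length π) * p) (ℚ.*-identityˡ p) ⟨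
    1ℚ * p + fromℕ (length π) * p
      ≡⟨ ℚ.*-distribʳ-+ p 1ℚ (fromℕ (length π)) ⟨
    (1ℚ + fromℕ (length π)) * p
      ≡⟨ cong (_* p) (fromℕ-suc (length π)) ⟨
    fromℕ (suc (length π)) * p ∎
    where open ℚ.≤-Reasoning

  sumOf-≤-sum : ∀ {f : Fin n → ℚ} xs → (∀ i → 0ℚ ≤ f i) → Unique xs → sumOf f xs ≤ sum f
  sumOf-≤-sum     []       0≤f []                 = sum-nonNeg 0≤f
  sumOf-≤-sum {f} (x ∷ xs) 0≤f (x∉xs ∷ xs-unique) = begin
    f x + sumOf f xs
      ≡⟨ cong (f x +_) (sumOf-cong xs (λ y∈xs → off-x (All.lookup x∉xs y∈xs ∘′ sym))) ⟨
    f x + sumOf f₀ xs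
      ≤⟨ ℚ.+-monoʳ-≤ (f x) (sumOf-≤-sum xs (λ i → ·-nonNeg (not ⌊ i ≟ x ⌋) (0≤f i)) xs-unique) ⟩
    f x + sum f₀
      ≡⟨ ℚ.+-comm (f x) (sum f₀) ⟩
    sum f₀ + f x
      ≡⟨ cong (sum f₀ +_) (sum-point x (f x)) ⟨
    sum f₀ + sum (λ i → ⌊ i ≟ x ⌋ · f x)
      ≡⟨ ∑-distrib-+ f₀ (λ i → ⌊ i ≟ x ⌋ · f x) ⟨
    sum (λ i → f₀ i + ⌊ i ≟ x ⌋ · f x)
      ≡⟨ sum-cong-≗ split ⟨
    sum f ∎
    where
    open ℚ.≤-Reasoning
    f₀ : Fin n → ℚ
    f₀ i = not ⌊ i ≟ x ⌋ · f i
    off-x : ∀ {i} → i ≢ x → f₀ i ≡ f i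
    off-x {i} i≢x = cong (λ b → not b · f i) (≢⇒⌊≟⌋≡false i≢x)
    split : ∀ i → f i ≡ f₀ i + ⌊ i ≟ x ⌋ · f x
    split i with i ≟ x
    ... | yes refl = sym (ℚ.+-identityˡ (f i))
    ... | no _     = sym (ℚ.+-identityʳ (f i))

-- Simple paths

module _ {G : Graph} where
  open Graph G

  edgesW-treeOf : ∀ {t u v} (w : Walk G t u v) {e} → e ∈ edgesW G w → treeOf e ≡ t
  edgesW-treeOf (step e treeOf-e _ w) (here refl) = treeOf-e
  edgesW-treeOf (step e _ _ w)        (there e∈w) = edgesW-treeOf w e∈w

  private
    start∈vertsW : ∀ {t u v} (w : Walk G t u v) → u ∈ vertsW G w
    start∈vertsW []             = here refl
    start∈vertsW (step _ _ _ _) = here refl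

    ends∈vertsW : ∀ {t u v} (w : Walk G t u v) {e} → e ∈ edgesW G w →
                  proj₁ (ends e) ∈ vertsW G w × proj₂ (ends e) ∈ vertsW G w
    ends∈vertsW (step e _ (inj₁ refl) w) (here refl) = here refl , there (start∈vertsW w)
    ends∈vertsW (step e _ (inj₂ refl) w) (here refl) = there (start∈vertsW w) , here refl
    ends∈vertsW (step _ _ _ w) (there e∈w) with ends∈vertsW w e∈w
    ... | x∈w , y∈w = there x∈w , there y∈w

    start-edge-fresh : ∀ {t u u′ v e} → Joins G e u u′ → (w : Walk G t u′ v) →
                       All (u ≢_) (vertsW G w) → e ∉ edgesW G w
    start-edge-fresh (inj₁ refl) w u∉w e∈w = All.lookup u∉w (proj₁ (ends∈vertsW w e∈w)) refl
    start-edge-fresh (inj₂ refl) w u∉w e∈w = All.lookup u∉w (proj₂ (ends∈vertsW w e∈w)) refl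

  IsPath⇒Unique-edgesW : ∀ {t u v} (w : Walk G t u v) → IsPath G w → Unique (edgesW G w)
  IsPath⇒Unique-edgesW []                 _                  = []
  IsPath⇒Unique-edgesW (step e _ joins w) (u∉w ∷ w-isPath) =
    All.tabulate (λ e′∈w e≡e′ → start-edge-fresh joins w u∉w (subst (_∈ edgesW G w) (sym e≡e′) e′∈w))
    ∷ IsPath⇒Unique-edgesW w w-isPath

module _ (P : Problem) where
  open Problem P

  -- Raising an instance

  δ : Duals P → Inst P → List (Edge P) → ℚ
  δ y d π = slack P y d * 1/[1+ length π ]

  δ-nonNeg : ∀ y d π → 0ℚ ≤ slack P y d → 0ℚ ≤ δ y d π
  δ-nonNeg y d π 0≤s = *-nonNeg 0≤s (1/[1+n]-nonNeg (length π))

  Hits : List (Edge P) → Inst P → Set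
  Hits π x = Σ (Edge P) λ e → e ∈ π × e ∈ path P x

  shared-edge⇒Overlap : ∀ {d x e} → e ∈ path P d → e ∈ path P x → Overlap P d x
  shared-edge⇒Overlap {d} {x} e∈d e∈x =
    trans (sym (edgesW-treeOf (pathW d) e∈d)) (edgesW-treeOf (pathW x) e∈x) , _ , e∈d , e∈x

  α-raise : ∀ y d π a → α (raise P y d π) a ≡ α y a + ⌊ a ≟ dem d ⌋ · δ y d π
  α-raise y d π a = if-+≡+· ⌊ a ≟ dem d ⌋ (α y a) (δ y d π)

  β-raise : ∀ y d π e → β (raise P y d π) e ≡ β y e + (e ∈ᵇ π) · δ y d π
  β-raise y d π e = if-+≡+· (e ∈ᵇ π) (β y e) (δ y d π)

  raiseGain : Duals P → Inst P → List (Edge P) → Inst P → ℚ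
  raiseGain y d π x = ⌊ dem x ≟ dem d ⌋ · δ y d π + sumOf (λ e → (e ∈ᵇ π) · δ y d π) (path P x)

  lhs-raise : ∀ y d π x → lhs P (raise P y d π) x ≡ lhs P y x + raiseGain y d π x
  lhs-raise y d π x = begin
    α y′ (dem x) + sumOf (β y′) (path P x)
      ≡⟨ cong₂ _+_ (α-raise y d π (dem x)) (sumOf-cong (path P x) (λ {e} _ → β-raise y d π e)) ⟩
    (α y (dem x) + a) + sumOf (λ e → β y e + (e ∈ᵇ π) · δ y d π) (path P x)
      ≡⟨ cong (α y (dem x) + a +_) (sumOf-+ (β y) (λ e → (e ∈ᵇ π) · δ y d π) (path P x)) ⟩
    (α y (dem x) + a) + (sumOf (β y) (path P x) + b)
      ≡⟨ solve 4 (λ p a q b → p :+ a :+ (q :+ b) := p :+ q :+ (a :+ b))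
               refl (α y (dem x)) a (sumOf (β y) (path P x)) b ⟩
    lhs P y x + raiseGain y d π x ∎
    where
    open ≡-Reasoning
    open +-*-Solver
    y′ = raise P y d π
    a = ⌊ dem x ≟ dem d ⌋ · δ y d π
    b = sumOf (λ e → (e ∈ᵇ π) · δ y d π) (path P x)

  raiseGain-nonNeg : ∀ y d π x → 0ℚ ≤ δ y d π → 0ℚ ≤ raiseGain y d π x
  raiseGain-nonNeg y d π x 0≤δ =
    +-nonNeg (·-nonNeg ⌊ dem x ≟ dem d ⌋ 0≤δ) (sumOf-nonNeg (path P x) (λ e → ·-nonNeg (e ∈ᵇ π) 0≤δ))

  raiseGain-hit : ∀ y d π x → 0ℚ ≤ δ y d π → dem d ≡ dem x ⊎ Hits π x → δ y d π ≤ raiseGain y d π x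
  raiseGain-hit y d π x 0≤δ (inj₁ dem-d≡dem-x) = begin
    δ y d π           ≤⟨ p≤p+q (δ y d π) (sumOf-nonNeg (path P x) (λ e → ·-nonNeg (e ∈ᵇ π) 0≤δ)) ⟩
    δ y d π + rest    ≡⟨ cong (λ b → b · δ y d π + rest) (≡⇒⌊≟⌋≡true (sym dem-d≡dem-x)) ⟨
    raiseGain y d π x ∎
    where
    open ℚ.≤-Reasoning
    rest = sumOf (λ e → (e ∈ᵇ π) · δ y d π) (path P x)
  raiseGain-hit y d π x 0≤δ (inj₂ (e , e∈π , e∈x)) = begin
    δ y d π                                     ≡⟨ cong (_· δ y d π) (∈⇒∈ᵇ e∈π) ⟨
    (e ∈ᵇ π) · δ y d π                          ≤⟨ ∈⇒≤sumOf (path P x) (λ e → ·-nonNeg (e ∈ᵇ π) 0≤δ) e∈x ⟩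
    sumOf (λ e → (e ∈ᵇ π) · δ y d π) (path P x) ≤⟨ p≤q+p (·-nonNeg ⌊ dem x ≟ dem d ⌋ 0≤δ) ⟩
    raiseGain y d π x                           ∎
    where open ℚ.≤-Reasoning

  raiseGain-miss : ∀ y d π x → dem x ≢ dem d → ¬ Hits π x → raiseGain y d π x ≡ 0ℚ
  raiseGain-miss y d π x dem-x≢dem-d π∌x = begin
    ⌊ dem x ≟ dem d ⌋ · δ y d π + sumOf (λ e → (e ∈ᵇ π) · δ y d π) (path P x)
      ≡⟨ cong₂ (λ b rest → b · δ y d π + rest) (≢⇒⌊≟⌋≡false dem-x≢dem-d)
               (sumOf-cong (path P x) (λ e∈x → cong (_· δ y d π) (∉⇒∈ᵇ (λ e∈π → π∌x (_ , e∈π , e∈x))))) ⟩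
    0ℚ + sumOf (λ _ → 0ℚ) (path P x)
      ≡⟨ trans (ℚ.+-identityˡ _) (sumOf-zero (path P x)) ⟩
    0ℚ ∎
    where open ≡-Reasoning

  lhs-raise-mono : ∀ y d π x → 0ℚ ≤ δ y d π → lhs P y x ≤ lhs P (raise P y d π) x
  lhs-raise-mono y d π x 0≤δ = begin
    lhs P y x                      ≤⟨ p≤p+q (lhs P y x) (raiseGain-nonNeg y d π x 0≤δ) ⟩
    lhs P y x + raiseGain y d π x  ≡⟨ lhs-raise y d π x ⟨
    lhs P (raise P y d π) x        ∎
    where open ℚ.≤-Reasoning

  lhs-raise-miss : ∀ y d π x → dem x ≢ dem d → ¬ Hits π x → lhs P (raise P y d π) x ≡ lhs P y x
  lhs-raise-miss y d π x dem-x≢dem-d π∌x = begin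
    lhs P (raise P y d π) x        ≡⟨ lhs-raise y d π x ⟩
    lhs P y x + raiseGain y d π x  ≡⟨ cong (lhs P y x +_) (raiseGain-miss y d π x dem-x≢dem-d π∌x) ⟩
    lhs P y x + 0ℚ                 ≡⟨ ℚ.+-identityʳ _ ⟩
    lhs P y x                      ∎
    where open ≡-Reasoning

  NonNegDuals : Duals P → Set
  NonNegDuals y = (∀ a → 0ℚ ≤ α y a) × (∀ e → 0ℚ ≤ β y e)

  raise-nonNeg : ∀ y d π → 0ℚ ≤ δ y d π → NonNegDuals y → NonNegDuals (raise P y d π)
  raise-nonNeg y d π 0≤δ (0≤α , 0≤β) =
    (λ a → subst (0ℚ ≤_) (sym (α-raise y d π a)) (+-nonNeg (0≤α a) (·-nonNeg ⌊ a ≟ dem d ⌋ 0≤δ))) ,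
    (λ e → subst (0ℚ ≤_) (sym (β-raise y d π e)) (+-nonNeg (0≤β e) (·-nonNeg (e ∈ᵇ π) 0≤δ)))

  lhs-nonNeg : ∀ y → NonNegDuals y → ∀ x → 0ℚ ≤ lhs P y x
  lhs-nonNeg y (0≤α , 0≤β) x = +-nonNeg (0≤α (dem x)) (sumOf-nonNeg (path P x) 0≤β)

  -- Weak duality

  dualValue : Duals P → ℚ
  dualValue y = sum (α y) + sum (β y)

  zeroDuals-nonNeg : NonNegDuals (zeroDuals P)
  zeroDuals-nonNeg = (λ _ → ℚ.≤-refl) , (λ _ → ℚ.≤-refl)

  dualValue-zeroDuals : dualValue (zeroDuals P) ≡ 0ℚ
  dualValue-zeroDuals = cong₂ _+_ (sum-replicate-zero nd) (sum-replicate-zero ne)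

  Independent⇒pairwise : ∀ O → Independent P O → AllPairs (λ d x → ¬ Conflict P d x) O
  Independent⇒pairwise O (O-unique , no-conflict) =
    Unique⇒AllPairs O O-unique (λ d∈O x∈O d≢x → no-conflict _ _ d∈O x∈O d≢x)

  Independent⇒Unique-dem : ∀ O → Independent P O → Unique (map dem O)
  Independent⇒Unique-dem O indep =
    AllPairs.map⁺ (AllPairs.map (λ d≁x dem-d≡dem-x → d≁x (inj₂ dem-d≡dem-x)) (Independent⇒pairwise O indep))

  Independent⇒Unique-edges : ∀ O → Independent P O → Unique (concat (map (path P) O))
  Independent⇒Unique-edges O indep = Unique.concat⁺
    (All.map⁺ (All.tabulate (λ {d} _ → IsPath⇒Unique-edgesW (pathW d) (pathW-simple d))))
    (AllPairs.map⁺ (AllPairs.map (λ d≁x {_} (e∈d , e∈x) → d≁x (inj₁ (shared-edge⇒Overlap e∈d e∈x)))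
                                 (Independent⇒pairwise O indep)))

  sumOf-lhs-≤-dualValue : ∀ y O → NonNegDuals y → Independent P O → sumOf (lhs P y) O ≤ dualValue y
  sumOf-lhs-≤-dualValue y O (0≤α , 0≤β) indep = begin
    sumOf (λ x → α y (dem x) + sumOf (β y) (path P x)) O
      ≡⟨ sumOf-+ (λ x → α y (dem x)) (λ x → sumOf (β y) (path P x)) O ⟩
    sumOf (λ x → α y (dem x)) O + sumOf (λ x → sumOf (β y) (path P x)) O
      ≡⟨ cong₂ _+_ (sumOf-map (α y) dem O) (sumOf-concatMap (β y) (path P) O) ⟨
    sumOf (α y) (map dem O) + sumOf (β y) (concat (map (path P) O))
      ≤⟨ ℚ.+-mono-≤ (sumOf-≤-sum (map dem O) 0≤α (Independent⇒Unique-dem O indep))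
                    (sumOf-≤-sum (concat (map (path P) O)) 0≤β (Independent⇒Unique-edges O indep)) ⟩
    dualValue y ∎
    where open ℚ.≤-Reasoning

  profitOf≡sumOf : ∀ S → profitOf P S ≡ sumOf (p P) S
  profitOf≡sumOf []      = refl
  profitOf≡sumOf (d ∷ S) = cong (p P d +_) (profitOf≡sumOf S)

  scaled-profit≤dualValue : ∀ ξ y O → (∀ d → Satisfied P ξ y d) → NonNegDuals y → Independent P O →
                            ξ * profitOf P O ≤ dualValue y
  scaled-profit≤dualValue ξ y O satisfied nonNeg indep = begin
    ξ * profitOf P O             ≡⟨ cong (ξ *_) (profitOf≡sumOf O) ⟩
    ξ * sumOf (p P) O            ≡⟨ sumOf-*ˡ (p P) ξ O ⟨
    sumOf (λ d → ξ * p P d) O    ≤⟨ sumOf-mono-≤ O satisfied ⟩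
    sumOf (lhs P y) O            ≤⟨ sumOf-lhs-≤-dualValue y O nonNeg indep ⟩
    dualValue y                  ∎
    where open ℚ.≤-Reasoning

  -- Growth of the dual objective during phase one

  dualValue-raise : ∀ y d π → 0ℚ ≤ δ y d π →
                    dualValue (raise P y d π) ≤ dualValue y + fromℕ (suc (length π)) * δ y d π
  dualValue-raise y d π 0≤δ = begin
    sum (α y′) + sum (β y′)
      ≡⟨ cong₂ _+_ (sum-cong-≗ (α-raise y d π)) (sum-cong-≗ (β-raise y d π)) ⟩
    sum (λ a → α y a + ⌊ a ≟ dem d ⌋ · c) + sum (λ e → β y e + (e ∈ᵇ π) · c)
      ≡⟨ cong₂ _+_ (∑-distrib-+ (α y) (λ a → ⌊ a ≟ dem d ⌋ · c))
                   (∑-distrib-+ (β y) (λ e → (e ∈ᵇ π) · c)) ⟩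
    (sum (α y) + sum (λ a → ⌊ a ≟ dem d ⌋ · c)) + (sum (β y) + sum (λ e → (e ∈ᵇ π) · c))
      ≤⟨ ℚ.+-mono-≤ (ℚ.≤-reflexive (cong (sum (α y) +_) (sum-point (dem d) c)))
                    (ℚ.+-monoʳ-≤ (sum (β y)) (sum-∈ᵇ-≤ π 0≤δ)) ⟩
    (sum (α y) + c) + (sum (β y) + fromℕ (length π) * c)
      ≡⟨ solve 4 (λ a b n c → (a :+ c) :+ (b :+ n :* c) := (a :+ b) :+ (con 1ℚ :+ n) :* c)
               refl (sum (α y)) (sum (β y)) (fromℕ (length π)) c ⟩
    dualValue y + (1ℚ + fromℕ (length π)) * c
      ≡⟨ cong (λ k → dualValue y + k * c) (fromℕ-suc (length π)) ⟨
    dualValue y + fromℕ (suc (length π)) * c ∎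
    where
    open ℚ.≤-Reasoning
    open +-*-Solver
    y′ = raise P y d π
    c = δ y d π

  Admissible : Duals P → Iter P → Set
  Admissible z []             = ⊤
  Admissible z ((d , π) ∷ it) =
    0ℚ ≤ slack P z d × All (λ dπ → ¬ Conflict P (proj₁ dπ) d) it × Admissible (raise P z d π) it

  AdmissibleRun : Duals P → List (Iter P) → Set
  AdmissibleRun z []         = ⊤
  AdmissibleRun z (it ∷ its) = Admissible z it × AdmissibleRun (raiseIter P z it) its

  Unsatisfied-raise-nonconflicting : ∀ {z d π x} → ¬ Conflict P x d → (∀ e → e ∈ π → e ∈ path P d) →
                                      Unsatisfied P z x → Unsatisfied P (raise P z d π) x
  Unsatisfied-raise-nonconflicting {z} {d} {π} {x} x≁d π⊆d =
    subst (_< p P x) (sym (lhs-raise-miss z d π x (x≁d ∘′ inj₂)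
      (λ (e , e∈π , e∈x) → x≁d (inj₁ (shared-edge⇒Overlap e∈x (π⊆d e e∈π))))))

  ValidIter⇒Admissible : ∀ z it → ValidIter P z it → Admissible z it
  ValidIter⇒Admissible z []             _ = tt
  ValidIter⇒Admissible z ((d , π) ∷ it) ((d∉it ∷ it-unique , no-conflict) , (unsat , _ , π⊆d) ∷ valid) =
    p≤q⇒0≤q-p (ℚ.<⇒≤ unsat) , it≁d ,
    ValidIter⇒Admissible (raise P z d π) it
      ((it-unique , λ x y x∈it y∈it → no-conflict x y (there x∈it) (there y∈it)) ,
       All.zipWith (λ (x≁d , conditions) →
                      Prod.map₁ (Unsatisfied-raise-nonconflicting {z} {d} {π} x≁d π⊆d) conditions)
                   (it≁d , valid))
    where
    it≁d : All (λ dπ → ¬ Conflict P (proj₁ dπ) d) it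
    it≁d = All.tabulate (λ dπ∈it → let x∈it = ∈-map⁺ proj₁ dπ∈it in
      no-conflict _ d (there x∈it) (here refl) (λ x≡d → All.lookup d∉it x∈it (sym x≡d)))

  ValidRun⇒AdmissibleRun : ∀ z its → ValidRun P z its → AdmissibleRun z its
  ValidRun⇒AdmissibleRun z []         _              = tt
  ValidRun⇒AdmissibleRun z (it ∷ its) (valid , run) =
    ValidIter⇒Admissible z it valid , ValidRun⇒AdmissibleRun (raiseIter P z it) its run

  raiseTotal : Duals P → Iter P → ℚ
  raiseTotal z []             = 0ℚ
  raiseTotal z ((d , π) ∷ it) = δ z d π + raiseTotal (raise P z d π) it

  runTotal : Duals P → List (Iter P) → ℚ
  runTotal z []         = 0ℚ
  runTotal z (it ∷ its) = raiseTotal z it + runTotal (raiseIter P z it) its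

  raiseIter-nonNeg : ∀ z it → Admissible z it → NonNegDuals z → NonNegDuals (raiseIter P z it)
  raiseIter-nonNeg z []             _                 nonNeg = nonNeg
  raiseIter-nonNeg z ((d , π) ∷ it) (0≤s , _ , admit) nonNeg =
    raiseIter-nonNeg (raise P z d π) it admit (raise-nonNeg z d π (δ-nonNeg z d π 0≤s) nonNeg)

  finalDuals-nonNeg : ∀ z its → AdmissibleRun z its → NonNegDuals z → NonNegDuals (finalDuals P z its)
  finalDuals-nonNeg z []         _                nonNeg = nonNeg
  finalDuals-nonNeg z (it ∷ its) (admit , admits) nonNeg =
    finalDuals-nonNeg (raiseIter P z it) its admits (raiseIter-nonNeg z it admit nonNeg)

  dualValue-raiseIter : ∀ z it M → Admissible z it → All (λ dπ → length (proj₂ dπ) ℕ.≤ M) it →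
                        dualValue (raiseIter P z it) ≤ dualValue z + fromℕ (suc M) * raiseTotal z it
  dualValue-raiseIter z [] M _ _ = ℚ.≤-reflexive (x≡x+k*0 (dualValue z) (fromℕ (suc M)))
  dualValue-raiseIter z ((d , π) ∷ it) M (0≤s , _ , admit) (|π|≤M ∷ |it|≤M) = begin
    dualValue (raiseIter P z′ it)
      ≤⟨ dualValue-raiseIter z′ it M admit |it|≤M ⟩
    dualValue z′ + K * raiseTotal z′ it
      ≤⟨ ℚ.+-monoˡ-≤ _ (dualValue-raise z d π 0≤δ) ⟩
    dualValue z + fromℕ (suc (length π)) * δ z d π + K * raiseTotal z′ it
      ≤⟨ ℚ.+-monoˡ-≤ (K * raiseTotal z′ it)
           (ℚ.+-monoʳ-≤ (dualValue z) (*-monoʳ-≤ 0≤δ (fromℕ-mono-≤ (ℕ.s≤s |π|≤M)))) ⟩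
    dualValue z + K * δ z d π + K * raiseTotal z′ it
      ≡⟨ x+k*a+k*b≡x+k*[a+b] (dualValue z) K (δ z d π) (raiseTotal z′ it) ⟩
    dualValue z + K * raiseTotal z ((d , π) ∷ it) ∎
    where
    open ℚ.≤-Reasoning
    z′ = raise P z d π
    K = fromℕ (suc M)
    0≤δ : 0ℚ ≤ δ z d π
    0≤δ = δ-nonNeg z d π 0≤s

  dualValue-finalDuals : ∀ z its M → AdmissibleRun z its →
                         (∀ {dπ} → dπ ∈ concat its → length (proj₂ dπ) ℕ.≤ M) →
                         dualValue (finalDuals P z its) ≤ dualValue z + fromℕ (suc M) * runTotal z its
  dualValue-finalDuals z [] M _ _ = ℚ.≤-reflexive (x≡x+k*0 (dualValue z) (fromℕ (suc M)))
  dualValue-finalDuals z (it ∷ its) M (admit , admits) |its|≤M = begin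
    dualValue (finalDuals P z′ its)
      ≤⟨ dualValue-finalDuals z′ its M admits (|its|≤M ∘′ ∈-++⁺ʳ it) ⟩
    dualValue z′ + K * runTotal z′ its
      ≤⟨ ℚ.+-monoˡ-≤ _ (dualValue-raiseIter z it M admit (All.tabulate (|its|≤M ∘′ ∈-++⁺ˡ))) ⟩
    dualValue z + K * raiseTotal z it + K * runTotal z′ its
      ≡⟨ x+k*a+k*b≡x+k*[a+b] (dualValue z) K (raiseTotal z it) (runTotal z′ its) ⟩
    dualValue z + K * runTotal z (it ∷ its) ∎
    where
    open ℚ.≤-Reasoning
    z′ = raiseIter P z it
    K = fromℕ (suc M)

  ∈⇒≤Δ : ∀ its {dπ} → dπ ∈ concat its → length (proj₂ dπ) ℕ.≤ Δ P its
  ∈⇒≤Δ its = go (concat its)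
    where
    go : ∀ (rs : List (Inst P × List (Edge P))) {dπ} → dπ ∈ rs →
         length (proj₂ dπ) ℕ.≤ foldr (λ rπ m → length (proj₂ rπ) ⊔ m) 0 rs
    go (r ∷ rs) (here refl)  = ℕ.m≤m⊔n _ _
    go (r ∷ rs) (there dπ∈rs) = ℕ.≤-trans (go rs dπ∈rs) (ℕ.m≤n⊔m _ _)

  scaled-profit≤[1+Δ]*runTotal : ∀ ξ its O → AdmissibleRun (zeroDuals P) its →
                                 (∀ d → Satisfied P ξ (finalDuals P (zeroDuals P) its) d) → Independent P O →
                                 ξ * profitOf P O ≤ fromℕ (suc (Δ P its)) * runTotal (zeroDuals P) its
  scaled-profit≤[1+Δ]*runTotal ξ its O admits satisfied indep = begin
    ξ * profitOf P O                ≤⟨ scaled-profit≤dualValue ξ (finalDuals P Z its) O satisfied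
                                         (finalDuals-nonNeg Z its admits zeroDuals-nonNeg) indep ⟩
    dualValue (finalDuals P Z its)  ≤⟨ dualValue-finalDuals Z its (Δ P its) admits (∈⇒≤Δ its) ⟩
    dualValue Z + K * runTotal Z its ≡⟨ cong (_+ K * runTotal Z its) dualValue-zeroDuals ⟩
    0ℚ + K * runTotal Z its         ≡⟨ ℚ.+-identityˡ _ ⟩
    K * runTotal Z its              ∎
    where
    open ℚ.≤-Reasoning
    Z = zeroDuals P
    K = fromℕ (suc (Δ P its))

  -- Phase two pays for every raise

  conflict?-sound : ∀ d x → T (conflict? P d x) → Conflict P d x
  conflict?-sound d x conflict with Equivalence.to (Bool.T-∨ {⌊ dem d ≟ dem x ⌋}) conflict
  ... | inj₁ same-demand = inj₂ (toWitness {a? = dem d ≟ dem x} same-demand)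
  ... | inj₂ same-tree∧shared-edge
    with find (Any.any⁻ _ (path P d) (proj₂ (Equivalence.to (Bool.T-∧ {⌊ tr d ≟ tr x ⌋}) same-tree∧shared-edge)))
  ... | e , e∈d , e∈ᵇx = inj₁ (shared-edge⇒Overlap e∈d (∈ᵇ⇒∈ e∈ᵇx))

  ¬Conflict⇒conflict?≡false : ∀ {d x} → ¬ Conflict P d x → conflict? P d x ≡ false
  ¬Conflict⇒conflict?≡false {d} {x} d≁x with conflict? P d x in eq
  ... | false = refl
  ... | true  = contradiction (conflict?-sound d x (subst T (sym eq) tt)) d≁x

  addIter : Iter P → List (Inst P) → List (Inst P)
  addIter []             S = S
  addIter ((d , _) ∷ it) S = addIter it (addIfOk P d S)

  addIter-⊆ : ∀ it S {x} → x ∈ addIter it S → (Σ (List (Edge P)) λ π → (x , π) ∈ it) ⊎ x ∈ S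
  addIter-⊆ []             S x∈S = inj₂ x∈S
  addIter-⊆ ((d , π) ∷ it) S x∈S′ with addIter-⊆ it (addIfOk P d S) x∈S′
  ... | inj₁ (π′ , x∈it) = inj₁ (π′ , there x∈it)
  ... | inj₂ x∈addIfOk with any (conflict? P d) S | x∈addIfOk
  ...   | true  | x∈S         = inj₂ x∈S
  ...   | false | here refl   = inj₁ (π , here refl)
  ...   | false | there x∈S   = inj₂ x∈S

  phase2-∷ : ∀ it its → phase2 P (it ∷ its) ≡ addIter it (phase2 P its)
  phase2-∷ it its = begin
    foldr add [] (reverse (concat (map (map proj₁) (reverse (it ∷ its)))))
      ≡⟨ cong (λ xss → foldr add [] (reverse (concat (map (map proj₁) xss)))) (List.unfold-reverse it its) ⟩
    foldr add [] (reverse (concat (map (map proj₁) (reverse its ++ it ∷ []))))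
      ≡⟨ cong (λ xss → foldr add [] (reverse (concat xss))) (List.map-++ (map proj₁) (reverse its) (it ∷ [])) ⟩
    foldr add [] (reverse (concat (later ++ map proj₁ it ∷ [])))
      ≡⟨ cong (λ xs → foldr add [] (reverse xs)) (List.concat-++ later (map proj₁ it ∷ [])) ⟨
    foldr add [] (reverse (concat later ++ (map proj₁ it ++ [])))
      ≡⟨ cong (λ xs → foldr add [] (reverse (concat later ++ xs))) (List.++-identityʳ (map proj₁ it)) ⟩
    foldr add [] (reverse (concat later ++ map proj₁ it))
      ≡⟨ cong (foldr add []) (List.reverse-++ (concat later) (map proj₁ it)) ⟩
    foldr add [] (reverse (map proj₁ it) ++ reverse (concat later))
      ≡⟨ List.foldr-++ add [] (reverse (map proj₁ it)) (reverse (concat later)) ⟩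
    foldr add (phase2 P its) (reverse (map proj₁ it))
      ≡⟨ List.reverse-foldr add (phase2 P its) (map proj₁ it) ⟩
    foldl (flip add) (phase2 P its) (map proj₁ it)
      ≡⟨ foldl-addIter it (phase2 P its) ⟩
    addIter it (phase2 P its) ∎
    where
    open ≡-Reasoning
    add = addIfOk P
    later = map (map proj₁) (reverse its)
    foldl-addIter : ∀ it S → foldl (flip add) S (map proj₁ it) ≡ addIter it S
    foldl-addIter []             S = refl
    foldl-addIter ((d , _) ∷ it) S = foldl-addIter it (add d S)

  phase2-⊆ : ∀ its {x} → x ∈ phase2 P its → Σ (List (Edge P)) λ π → (x , π) ∈ concat its
  phase2-⊆ (it ∷ its) x∈S rewrite phase2-∷ it its with addIter-⊆ it (phase2 P its) x∈S
  ... | inj₁ (π , x∈it)  = π , ∈-++⁺ˡ x∈it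
  ... | inj₂ x∈S′ with phase2-⊆ its x∈S′
  ...   | π , x∈its = π , ∈-++⁺ʳ it x∈its

  -- The members of an iteration do not conflict with one another, so the ones conflicting
  -- with S are exactly those that phase two rejects when it adds the iteration to S.
  rejectedTotal : Duals P → Iter P → List (Inst P) → ℚ
  rejectedTotal z []             S = 0ℚ
  rejectedTotal z ((d , π) ∷ it) S = any (conflict? P d) S · δ z d π + rejectedTotal (raise P z d π) it S

  rejectedTotal-∷ : ∀ z it S {d} → All (λ dπ → ¬ Conflict P (proj₁ dπ) d) it →
                    rejectedTotal z it (d ∷ S) ≡ rejectedTotal z it S
  rejectedTotal-∷ z []             S _             = refl
  rejectedTotal-∷ z ((x , π) ∷ it) S (x≁d ∷ it≁d) =
    cong₂ _+_ (cong (λ b → (b ∨ any (conflict? P x) S) · δ z x π) (¬Conflict⇒conflict?≡false x≁d))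
              (rejectedTotal-∷ (raise P z x π) it S it≁d)

  -- A d conflicting with some x ∈ S has, by interference, raised the left-hand side of x by at least δ.
  sumOf-lhs-raise : ∀ z d π S → 0ℚ ≤ δ z d π → (∀ {x} → x ∈ S → Overlap P d x → Hits π x) →
                    sumOf (lhs P z) S + any (conflict? P d) S · δ z d π ≤ sumOf (lhs P (raise P z d π)) S
  sumOf-lhs-raise z d π S 0≤δ hits = begin
    sumOf (lhs P z) S + any (conflict? P d) S · δ z d π
      ≤⟨ ℚ.+-monoʳ-≤ (sumOf (lhs P z) S) charged ⟩
    sumOf (lhs P z) S + sumOf (raiseGain z d π) S
      ≡⟨ sumOf-+ (lhs P z) (raiseGain z d π) S ⟨
    sumOf (λ x → lhs P z x + raiseGain z d π x) S
      ≡⟨ sumOf-cong S (λ {x} _ → lhs-raise z d π x) ⟨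
    sumOf (lhs P (raise P z d π)) S ∎
    where
    open ℚ.≤-Reasoning
    charged : any (conflict? P d) S · δ z d π ≤ sumOf (raiseGain z d π) S
    charged = ·-≤ (any (conflict? P d) S) (sumOf-nonNeg S (λ x → raiseGain-nonNeg z d π x 0≤δ)) λ conflicts →
      let x , x∈S , d~x = find (Any.any⁻ (conflict? P d) S conflicts) in begin
      δ z d π
        ≤⟨ raiseGain-hit z d π x 0≤δ (Sum.map₂ (hits x∈S) (Sum.swap (conflict?-sound d x d~x))) ⟩
      raiseGain z d π x
        ≤⟨ ∈⇒≤sumOf S (λ x → raiseGain-nonNeg z d π x 0≤δ) x∈S ⟩
      sumOf (raiseGain z d π) S ∎

  sumOf-lhs-raiseIter : ∀ z it S → Admissible z it →
                        (∀ {d π x} → (d , π) ∈ it → x ∈ S → Overlap P d x → Hits π x) →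
                        sumOf (lhs P z) S + rejectedTotal z it S ≤ sumOf (lhs P (raiseIter P z it)) S
  sumOf-lhs-raiseIter z []             S _                 _    = ℚ.≤-reflexive (ℚ.+-identityʳ _)
  sumOf-lhs-raiseIter z ((d , π) ∷ it) S (0≤s , _ , admit) hits = begin
    sumOf (lhs P z) S + (any (conflict? P d) S · δ z d π + rejectedTotal z′ it S)
      ≡⟨ ℚ.+-assoc (sumOf (lhs P z) S) _ _ ⟨
    sumOf (lhs P z) S + any (conflict? P d) S · δ z d π + rejectedTotal z′ it S
      ≤⟨ ℚ.+-monoˡ-≤ (rejectedTotal z′ it S) (sumOf-lhs-raise z d π S (δ-nonNeg z d π 0≤s) (hits (here refl))) ⟩
    sumOf (lhs P z′) S + rejectedTotal z′ it S
      ≤⟨ sumOf-lhs-raiseIter z′ it S admit (hits ∘′ there) ⟩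
    sumOf (lhs P (raiseIter P z′ it)) S ∎
    where
    open ℚ.≤-Reasoning
    z′ = raise P z d π

  δ+lhs≤profit : ∀ y z d π → 0ℚ ≤ slack P z d → lhs P y d ≤ lhs P z d → δ z d π + lhs P y d ≤ p P d
  δ+lhs≤profit y z d π 0≤s y≤z = begin
    δ z d π + lhs P y d              ≤⟨ ℚ.+-mono-≤ (*1/[1+n]≤ (length π) 0≤s) y≤z ⟩
    (p P d - lhs P z d) + lhs P z d  ≡⟨ solve 2 (λ p l → (p :- l) :+ l := p) refl (p P d) (lhs P z d) ⟩
    p P d                            ∎
    where
    open ℚ.≤-Reasoning
    open +-*-Solver

  -- An accepted d pays for its own δ, which is at most its slack.
  addIfOk-charging : ∀ y c z d π it S b → 0ℚ ≤ slack P z d → lhs P y d ≤ lhs P z d →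
                     All (λ dπ → ¬ Conflict P (proj₁ dπ) d) it →
                     c + sumOf (lhs P y) S + (b · δ z d π + rejectedTotal (raise P z d π) it S) ≤ profitOf P S →
                     let S′ = if b then S else d ∷ S in
                     c + δ z d π + sumOf (lhs P y) S′ + rejectedTotal (raise P z d π) it S′ ≤ profitOf P S′
  addIfOk-charging y c z d π it S true 0≤s y≤z it≁d paid = begin
    c + δ₀ + L + R    ≡⟨ solve 4 (λ c a s r → c :+ a :+ s :+ r := c :+ s :+ (a :+ r)) refl c δ₀ L R ⟩
    c + L + (δ₀ + R)  ≤⟨ paid ⟩
    profitOf P S      ∎
    where
    open ℚ.≤-Reasoning
    open +-*-Solver
    δ₀ = δ z d π
    L = sumOf (lhs P y) S
    R = rejectedTotal (raise P z d π) it S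
  addIfOk-charging y c z d π it S false 0≤s y≤z it≁d paid = begin
    c + δ₀ + (lhs P y d + L) + rejectedTotal (raise P z d π) it (d ∷ S)
      ≡⟨ cong (c + δ₀ + (lhs P y d + L) +_) (rejectedTotal-∷ (raise P z d π) it S it≁d) ⟩
    c + δ₀ + (lhs P y d + L) + R
      ≡⟨ solve 5 (λ c a l s r → c :+ a :+ (l :+ s) :+ r := c :+ s :+ (con 0ℚ :+ r) :+ (a :+ l))
               refl c δ₀ (lhs P y d) L R ⟩
    c + L + (0ℚ + R) + (δ₀ + lhs P y d)
      ≤⟨ ℚ.+-mono-≤ paid (δ+lhs≤profit y z d π 0≤s y≤z) ⟩
    profitOf P S + p P d
      ≡⟨ ℚ.+-comm (profitOf P S) (p P d) ⟩
    p P d + profitOf P S ∎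
    where
    open ℚ.≤-Reasoning
    open +-*-Solver
    δ₀ = δ z d π
    L = sumOf (lhs P y) S
    R = rejectedTotal (raise P z d π) it S

  addIter-charging : ∀ y c z it S → Admissible z it → (∀ x → lhs P y x ≤ lhs P z x) →
                     c + sumOf (lhs P y) S + rejectedTotal z it S ≤ profitOf P S →
                     c + raiseTotal z it + sumOf (lhs P y) (addIter it S) ≤ profitOf P (addIter it S)
  addIter-charging y c z [] S _ _ paid = begin
    c + 0ℚ + sumOf (lhs P y) S  ≡⟨ solve 2 (λ c s → c :+ con 0ℚ :+ s := c :+ s :+ con 0ℚ) refl c _ ⟩
    c + sumOf (lhs P y) S + 0ℚ  ≤⟨ paid ⟩
    profitOf P S                ∎
    where
    open ℚ.≤-Reasoning
    open +-*-Solver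
  addIter-charging y c z ((d , π) ∷ it) S (0≤s , it≁d , admit) y≤z paid = begin
    c + (δ z d π + raiseTotal z′ it) + sumOf (lhs P y) S″
      ≡⟨ solve 4 (λ c a r s → c :+ (a :+ r) :+ s := c :+ a :+ r :+ s) refl c (δ z d π) (raiseTotal z′ it) _ ⟩
    c + δ z d π + raiseTotal z′ it + sumOf (lhs P y) S″
      ≤⟨ addIter-charging y (c + δ z d π) z′ it (addIfOk P d S) admit y≤z′
           (addIfOk-charging y c z d π it S (any (conflict? P d) S) 0≤s (y≤z d) it≁d paid) ⟩
    profitOf P S″ ∎
    where
    open ℚ.≤-Reasoning
    open +-*-Solver
    z′ = raise P z d π
    S″ = addIter it (addIfOk P d S)
    y≤z′ : ∀ x → lhs P y x ≤ lhs P z′ x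
    y≤z′ x = ℚ.≤-trans (y≤z x) (lhs-raise-mono z d π x (δ-nonNeg z d π 0≤s))

  LaterHits : List (Iter P) → Set
  LaterHits []         = ⊤
  LaterHits (it ∷ its) =
    (∀ {d π x π′} → (d , π) ∈ it → (x , π′) ∈ concat its → Overlap P d x → Hits π x) × LaterHits its

  private
    lookupℕ-++ʳ : ∀ xs ys j → lookupℕ P (xs ++ ys) (length xs ℕ.+ j) ≡ lookupℕ P ys j
    lookupℕ-++ʳ []       ys j = refl
    lookupℕ-++ʳ (_ ∷ xs) ys j = lookupℕ-++ʳ xs ys j

    lookupℕ-++ˡ : ∀ xs ys {i} → i ℕ.< length xs → lookupℕ P (xs ++ ys) i ≡ lookupℕ P xs i
    lookupℕ-++ˡ (_ ∷ xs) ys {zero}  _           = refl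
    lookupℕ-++ˡ (_ ∷ xs) ys {suc i} (ℕ.s≤s i<n) = lookupℕ-++ˡ xs ys i<n

    ∈⇒lookupℕ : ∀ xs {x} → x ∈ xs → Σ ℕ λ i → i ℕ.< length xs × lookupℕ P xs i ≡ just x
    ∈⇒lookupℕ (x ∷ xs) (here refl) = zero , ℕ.s≤s ℕ.z≤n , refl
    ∈⇒lookupℕ (x ∷ xs) (there x∈xs) with ∈⇒lookupℕ xs x∈xs
    ... | i , i<n , lookup≡x = suc i , ℕ.s≤s i<n , lookup≡x

  Interference⇒LaterHits : ∀ its → Interference P its → LaterHits its
  Interference⇒LaterHits []         _         = tt
  Interference⇒LaterHits (it ∷ its) interfere = hits , Interference⇒LaterHits its interfere-later
    where
    hits : ∀ {d π x π′} → (d , π) ∈ it → (x , π′) ∈ concat its → Overlap P d x → Hits π x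
    hits {d} {π} {x} {π′} dπ∈it xπ′∈its with ∈⇒lookupℕ it dπ∈it | ∈⇒lookupℕ (concat its) xπ′∈its
    ... | i , i<|it| , it[i] | j , _ , its[j] =
      interfere i (length it ℕ.+ j) d x π π′
        (trans (lookupℕ-++ˡ it (concat its) i<|it|) it[i])
        (trans (lookupℕ-++ʳ it (concat its) j) its[j])
        (ℕ.<-≤-trans i<|it| (ℕ.m≤m+n (length it) j))
    interfere-later : Interference P its
    interfere-later i j d₁ d₂ π₁ π₂ its[i] its[j] i<j =
      interfere (length it ℕ.+ i) (length it ℕ.+ j) d₁ d₂ π₁ π₂
        (trans (lookupℕ-++ʳ it (concat its) i) its[i])
        (trans (lookupℕ-++ʳ it (concat its) j) its[j])
        (ℕ.+-monoʳ-< (length it) i<j)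

  phase2-charging : ∀ y its → AdmissibleRun y its → LaterHits its →
                    runTotal y its + sumOf (lhs P y) (phase2 P its) ≤ profitOf P (phase2 P its)
  phase2-charging y []         _                _                  = ℚ.≤-refl
  phase2-charging y (it ∷ its) (admit , admits) (hits , later-hits) rewrite phase2-∷ it its = begin
    raiseTotal y it + C + sumOf (lhs P y) (addIter it S)
      ≡⟨ cong (_+ sumOf (lhs P y) (addIter it S)) (ℚ.+-comm _ C) ⟩
    C + raiseTotal y it + sumOf (lhs P y) (addIter it S)
      ≤⟨ addIter-charging y C y it S admit (λ _ → ℚ.≤-refl) paid ⟩
    profitOf P (addIter it S) ∎
    where
    open ℚ.≤-Reasoning
    C = runTotal (raiseIter P y it) its
    S = phase2 P its
    hits-S : ∀ {d π x} → (d , π) ∈ it → x ∈ S → Overlap P d x → Hits π x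
    hits-S dπ∈it x∈S = hits dπ∈it (proj₂ (phase2-⊆ its x∈S))
    paid : C + sumOf (lhs P y) S + rejectedTotal y it S ≤ profitOf P S
    paid = begin
      C + sumOf (lhs P y) S + rejectedTotal y it S    ≡⟨ ℚ.+-assoc C _ _ ⟩
      C + (sumOf (lhs P y) S + rejectedTotal y it S)  ≤⟨ ℚ.+-monoʳ-≤ C (sumOf-lhs-raiseIter y it S admit hits-S) ⟩
      C + sumOf (lhs P (raiseIter P y it)) S          ≤⟨ phase2-charging (raiseIter P y it) its admits later-hits ⟩
      profitOf P S                                    ∎

  runTotal≤profitOf-phase2 : ∀ y its → NonNegDuals y → AdmissibleRun y its → LaterHits its →
                             runTotal y its ≤ profitOf P (phase2 P its)
  runTotal≤profitOf-phase2 y its nonNeg admits hits =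
    ℚ.≤-trans (p≤p+q (runTotal y its) (sumOf-nonNeg (phase2 P its) (lhs-nonNeg y nonNeg)))
              (phase2-charging y its admits hits)

open import Data.Integer using (+_)

lemma1 : (P : Problem) (its : List (Iter P)) →
    ValidRun P (zeroDuals P) its →
    Interference P its →
    (λ' : ℚ) → 0ℚ ≤ λ' → λ' ≤ 1ℚ →
    (∀ d → Satisfied P λ' (finalDuals P (zeroDuals P) its) d) →
    (∀ ξ → 0ℚ ≤ ξ → ξ ≤ 1ℚ → (∀ d → Satisfied P ξ (finalDuals P (zeroDuals P) its) d) → ξ ≤ λ') →
    (O : List (Inst P)) → Independent P O →
    (λ' * ((+ 1) / suc (Δ P its))) * profitOf P O ≤ profitOf P (phase2 P its)
lemma1 P its valid interference λ′ _ _ λ′-satisfied _ O independent = begin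
  λ′ * 1/[1+ Δ P its ] * profitOf P O    ≡⟨ solve 3 (λ l r o → l :* r :* o := r :* (l :* o))
                                                refl λ′ 1/[1+ Δ P its ] (profitOf P O) ⟩
  1/[1+ Δ P its ] * (λ′ * profitOf P O)  ≤⟨ *-monoˡ-≤ (1/[1+n]-nonNeg (Δ P its)) λ′Opt≤[1+Δ]S ⟩
  1/[1+ Δ P its ] * (K * profitOf P S)   ≡⟨ 1/[1+n]*[[1+n]*p]≡p (Δ P its) (profitOf P S) ⟩
  profitOf P S                           ∎
  where
  open ℚ.≤-Reasoning
  open +-*-Solver
  S = phase2 P its
  K = fromℕ (suc (Δ P its))
  admissible : AdmissibleRun P (zeroDuals P) its
  admissible = ValidRun⇒AdmissibleRun P (zeroDuals P) its valid
  λ′Opt≤[1+Δ]S : λ′ * profitOf P O ≤ K * profitOf P S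
  λ′Opt≤[1+Δ]S = begin
    λ′ * profitOf P O                ≤⟨ scaled-profit≤[1+Δ]*runTotal P λ′ its O admissible λ′-satisfied independent ⟩
    K * runTotal P (zeroDuals P) its  ≤⟨ *-monoˡ-≤ (fromℕ-nonNeg (suc (Δ P its)))
                                          (runTotal≤profitOf-phase2 P (zeroDuals P) its (zeroDuals-nonNeg P) admissible
                                            (Interference⇒LaterHits P its interference)) ⟩
    K * profitOf P S                 ∎
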